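{- Let $f:\{0,1\}^n\to\{0,1\}$ be such that for some $I_1\neq I_2\subseteq N$ we have $f(x_{I_1})=f(x_{I_2})=1$ and $f(x_I)=0$ for all $I\subseteq N$ with $I\notin\{I_1,I_2\}$. Then the Lasserre relaxation at level $n-1$ of the unconstrained problem $\min\{f(x)\mid x\in\{0,1\}^n\}$ has no integrality gap.
   Context: $N=\{1,\dots,n\}$. For $I\subseteq N$, $x_I\in\{0,1\}^n$ has $x_i=1$ iff $i\in I$. Write $f(x)=\sum_{I\subseteq N}f_I\prod_{i\in I}x_i$ (multilinear representation). $\mathcal{P}_t(N)$ is the set of subsets of $N$ of size at most $t$; $M_t(y)$ is the matrix indexed by $\mathcal{P}_t(N)$ with $(I,J)$-entry $y_{I\cup J}$. The level-$(n-1)$ Lasserre relaxation is $\min\{\sum_If_Iy_I\mid y\in\mathbb{R}^{\mathcal{P}_{2n-2}(N)},\ y_\varnothing=1,\ M_{n-1}(y)\succeq0\}$; it has an integrality gap if its optimal value is strictly smaller than $\min_xf(x)$.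
   Formalization: The relaxation variables $y$ and the vectors testing positive semidefiniteness of $M_{n-1}(y)$ take rational rather than real values. -}

module Defs where

open import Data.Bool using (Bool; true; false; if_then_else_)
open import Data.Nat using (ℕ; zero; suc; _∸_) renaming (_*_ to _*ℕ_; _≤_ to _≤ℕ_)
open import Data.Nat using (_≤?_)
open import Data.Rational using (ℚ; 0ℚ; 1ℚ; _+_; _*_; _≤_; _<_)
open import Data.List using (List; []; _∷_; map; _++_; foldr; filter)
open import Data.Vec using (Vec; []; _∷_)
open import Data.Fin.Subset using (Subset; _∪_; ∣_∣; inside; outside)
open import Relation.Nullary.Decidable using (does)

-- Points of {0,1}^n and subsets of N = {1..n} are both identified with
-- Subset n (characteristic vectors); x_I is just I.

allSubsets : (n : ℕ) → List (Subset n)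
allSubsets zero = [] ∷ []
allSubsets (suc n) = map (inside ∷_) (allSubsets n) ++ map (outside ∷_) (allSubsets n)

sumL : {A : Set} → List A → (A → ℚ) → ℚ
sumL xs g = foldr (λ a s → g a + s) 0ℚ xs

ΣSub : (n : ℕ) → (Subset n → ℚ) → ℚ
ΣSub n g = sumL (allSubsets n) g

𝒫 : (n t : ℕ) → List (Subset n)
𝒫 n t = filter (λ I → ∣ I ∣ ≤? t) (allSubsets n)

monomial : {n : ℕ} → Subset n → Subset n → ℚ
monomial [] [] = 1ℚ
monomial (true ∷ I) (xi ∷ x) = (if xi then 1ℚ else 0ℚ) * monomial I x
monomial (false ∷ I) (xi ∷ x) = monomial I x

IsMultilinearRep : (n : ℕ) → (Subset n → ℚ) → (Subset n → ℚ) → Set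
IsMultilinearRep n f c = (x : Subset n) → f x ≡' ΣSub n (λ I → c I * monomial I x)
  where
  open import Relation.Binary.PropositionalEquality renaming (_≡_ to _≡'_)

-- Minimum of f over {0,1}^n (n-fold list minimum; allSubsets n is nonempty).
minL : List ℚ → ℚ → ℚ
minL [] d = d
minL (q ∷ qs) d = Data.Rational._⊓_ q (minL qs d)
  where import Data.Rational

minF : (n : ℕ) → (Subset n → ℚ) → ℚ
minF n f = minL (map f (allSubsets n)) (f (Data.Vec.replicate n outside))
  where import Data.Vec

MomentPSD : (n t : ℕ) → (Subset n → ℚ) → Set
MomentPSD n t y = (v : Subset n → ℚ) →
  0ℚ ≤ sumL (𝒫 n t) (λ I → sumL (𝒫 n t) (λ J → v I * v J * y (I ∪ J)))

-- Feasibility for the level-(n-1) Lasserre relaxation: y indexed by 𝒫_{2n-2}(N)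
-- (represented as a function on all subsets; entries of size > 2n-2 are ignored).
LasserreFeasible : (n : ℕ) → (Subset n → ℚ) → Set
LasserreFeasible n y = (y (Data.Vec.replicate n outside) ≡' 1ℚ) × MomentPSD n (n ∸ 1) y
  where
  import Data.Vec
  open import Data.Product using (_×_)
  open import Relation.Binary.PropositionalEquality renaming (_≡_ to _≡'_)

lasserreObj : (n : ℕ) → (Subset n → ℚ) → (Subset n → ℚ) → ℚ
lasserreObj n c y = sumL (𝒫 n (2 *ℕ n ∸ 2)) (λ I → c I * y I)

NoIntegralityGap : (n : ℕ) → (f c : Subset n → ℚ) → Set
NoIntegralityGap n f c = (y : Subset n → ℚ) → LasserreFeasible n y → minF n f ≤ lasserreObj n c y

{-# OPTIONS --safe #-}
-- For n ≥ 2 the function f is a single square. Let δ_A be the indicator of the point A and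
-- choose s = ±1 so that the coefficients of x_N in δ_{I₁} and s·δ_{I₂} cancel; then
-- h = δ_{I₁} + s·δ_{I₂} has degree ≤ n - 1 and f = h² on {0,1}ⁿ. Möbius inversion writes any y
-- as the moment sequence of a signed measure μ on {0,1}ⁿ, and then both vᵀ M_{n-1}(y) v, for v
-- the coefficient vector of h, and Σ_K f_K y_K equal Σₓ μ(x) f(x). So a feasible y has
-- objective ≥ 0, which is min f because f vanishes at some third point.
-- For n = 1 the level-0 objective is just f(∅).
module Submission where

open import Defs
open import Data.Nat using (ℕ)
open import Data.Rational using (ℚ; 0ℚ; 1ℚ)
open import Data.Fin.Subset using (Subset)
open import Relation.Binary.PropositionalEquality using (_≡_; _≢_)

open import Algebra.Bundles using (CommutativeMonoid)
import Algebra.Properties.CommutativeSemigroup as CommSemigroupProperties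
open import Data.Bool using (Bool; true; false; if_then_else_; not)
import Data.Bool as Bool
open import Data.Bool.Properties using (not-¬)
open import Data.Empty using (⊥-elim)
open import Data.Fin.Subset using (_∪_; ∣_∣; inside; outside; ⊤)
open import Data.Fin.Subset.Properties using (∣p∣≤n; ∣p∣≡n⇒p≡⊤)
open import Data.List using (List; []; _∷_; map; _++_; filter)
open import Data.List.Membership.Propositional using (_∈_)
open import Data.List.Membership.Propositional.Properties using (∈-map⁺; ∈-++⁺ˡ; ∈-++⁺ʳ)
open import Data.List.Relation.Unary.Any using (here; there)
open import Data.Nat using (zero; suc; _∸_; _<_; s≤s)
  renaming (_+_ to _+ℕ_; _*_ to _*ℕ_; _≤_ to _≤ℕ_; _≤?_ to _≤ℕ?_)
import Data.Nat.Properties as ℕₚ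
open import Data.Product using (∃; _×_; _,_)
open import Data.Rational using (_+_; _*_; -_; _-_; _≤_)
import Data.Rational.Properties as ℚₚ
open import Data.Vec using ([]; _∷_; replicate)
open import Data.Vec.Properties using (≡-dec; ∷-injectiveˡ; ∷-injectiveʳ)
open import Function using (_∘_)
open import Level using (0ℓ)
open import Relation.Binary.PropositionalEquality using (refl; sym; trans; cong; cong₂; subst; module ≡-Reasoning)
open import Relation.Nullary using (¬_; Dec; yes; no; does)
open import Relation.Nullary.Decidable using (dec-true; dec-false; dec⇒maybe)
open import Relation.Unary using (Decidable)
open import Tactic.RingSolver using (solve-∀)
open import Tactic.RingSolver.Core.AlmostCommutativeRing using (AlmostCommutativeRing; fromCommutativeRing)

open CommSemigroupProperties (CommutativeMonoid.commutativeSemigroup ℚₚ.+-0-commutativeMonoid)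
  using () renaming (interchange to +-interchange)
open CommSemigroupProperties (CommutativeMonoid.commutativeSemigroup ℚₚ.*-1-commutativeMonoid)
  using () renaming (x∙yz≈y∙xz to *-leftSwap; interchange to *-interchange)

-- Without the exact zero test the solver cannot cancel p - p.
ℚ-ring : AlmostCommutativeRing 0ℓ 0ℓ
ℚ-ring = fromCommutativeRing ℚₚ.+-*-commutativeRing (λ q → dec⇒maybe (0ℚ ℚₚ.≟ q))

sumL-++ : {A : Set} (xs ys : List A) (g : A → ℚ) → sumL (xs ++ ys) g ≡ sumL xs g + sumL ys g
sumL-++ []       ys g = sym (ℚₚ.+-identityˡ _)
sumL-++ (x ∷ xs) ys g = trans (cong (g x +_) (sumL-++ xs ys g)) (sym (ℚₚ.+-assoc (g x) _ _))

sumL-map : {A B : Set} (h : A → B) (xs : List A) (g : B → ℚ) → sumL (map h xs) g ≡ sumL xs (g ∘ h)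
sumL-map h []       g = refl
sumL-map h (x ∷ xs) g = cong (g (h x) +_) (sumL-map h xs g)

sumL-cong : {A : Set} (xs : List A) {g k : A → ℚ} → (∀ x → g x ≡ k x) → sumL xs g ≡ sumL xs k
sumL-cong []       g≡k = refl
sumL-cong (x ∷ xs) g≡k = cong₂ _+_ (g≡k x) (sumL-cong xs g≡k)

sumL-filter : {A : Set} {P : A → Set} (P? : Decidable P) (xs : List A) (g : A → ℚ) →
  (∀ x → ¬ P x → g x ≡ 0ℚ) → sumL (filter P? xs) g ≡ sumL xs g
sumL-filter P? []       g g≡0 = refl
sumL-filter P? (x ∷ xs) g g≡0 with P? x
... | yes _  = cong (g x +_) (sumL-filter P? xs g g≡0)
... | no ¬px = begin
  sumL (filter P? xs) g  ≡⟨ sumL-filter P? xs g g≡0 ⟩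
  sumL xs g              ≡⟨ sym (ℚₚ.+-identityˡ _) ⟩
  0ℚ + sumL xs g         ≡⟨ cong (_+ sumL xs g) (sym (g≡0 x ¬px)) ⟩
  g x + sumL xs g        ∎
  where open ≡-Reasoning

cubeSum : (n : ℕ) → (Subset n → ℚ) → ℚ
cubeSum zero    g = g []
cubeSum (suc n) g = cubeSum n (g ∘ (inside ∷_)) + cubeSum n (g ∘ (outside ∷_))

ΣSub≡cubeSum : ∀ n (g : Subset n → ℚ) → ΣSub n g ≡ cubeSum n g
ΣSub≡cubeSum zero    g = ℚₚ.+-identityʳ _
ΣSub≡cubeSum (suc n) g = begin
  sumL (map (inside ∷_) (allSubsets n) ++ map (outside ∷_) (allSubsets n)) g
    ≡⟨ sumL-++ (map (inside ∷_) (allSubsets n)) _ g ⟩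
  sumL (map (inside ∷_) (allSubsets n)) g + sumL (map (outside ∷_) (allSubsets n)) g
    ≡⟨ cong₂ _+_ (sumL-map (inside ∷_) (allSubsets n) g) (sumL-map (outside ∷_) (allSubsets n) g) ⟩
  ΣSub n (g ∘ (inside ∷_)) + ΣSub n (g ∘ (outside ∷_))
    ≡⟨ cong₂ _+_ (ΣSub≡cubeSum n _) (ΣSub≡cubeSum n _) ⟩
  cubeSum (suc n) g ∎
  where open ≡-Reasoning

cubeSum-cong : ∀ n {g k : Subset n → ℚ} → (∀ x → g x ≡ k x) → cubeSum n g ≡ cubeSum n k
cubeSum-cong zero    g≡k = g≡k []
cubeSum-cong (suc n) g≡k = cong₂ _+_ (cubeSum-cong n (g≡k ∘ (inside ∷_))) (cubeSum-cong n (g≡k ∘ (outside ∷_)))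

cubeSum-0 : ∀ n {g : Subset n → ℚ} → (∀ x → g x ≡ 0ℚ) → cubeSum n g ≡ 0ℚ
cubeSum-0 zero    g≡0 = g≡0 []
cubeSum-0 (suc n) g≡0 = cong₂ _+_ (cubeSum-0 n (g≡0 ∘ (inside ∷_))) (cubeSum-0 n (g≡0 ∘ (outside ∷_)))

cubeSum-+ : ∀ n (g k : Subset n → ℚ) → cubeSum n (λ x → g x + k x) ≡ cubeSum n g + cubeSum n k
cubeSum-+ zero    g k = refl
cubeSum-+ (suc n) g k = trans
  (cong₂ _+_ (cubeSum-+ n (g ∘ (inside ∷_)) (k ∘ (inside ∷_)))
             (cubeSum-+ n (g ∘ (outside ∷_)) (k ∘ (outside ∷_))))
  (+-interchange (cubeSum n (g ∘ (inside ∷_))) (cubeSum n (k ∘ (inside ∷_)))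
               (cubeSum n (g ∘ (outside ∷_))) (cubeSum n (k ∘ (outside ∷_))))

cubeSum-*ˡ : ∀ n (a : ℚ) (g : Subset n → ℚ) → cubeSum n (λ x → a * g x) ≡ a * cubeSum n g
cubeSum-*ˡ zero    a g = refl
cubeSum-*ˡ (suc n) a g = trans
  (cong₂ _+_ (cubeSum-*ˡ n a (g ∘ (inside ∷_))) (cubeSum-*ˡ n a (g ∘ (outside ∷_))))
  (sym (ℚₚ.*-distribˡ-+ a _ _))

cubeSum-*ʳ : ∀ n (a : ℚ) (g : Subset n → ℚ) → cubeSum n (λ x → g x * a) ≡ cubeSum n g * a
cubeSum-*ʳ zero    a g = refl
cubeSum-*ʳ (suc n) a g = trans
  (cong₂ _+_ (cubeSum-*ʳ n a (g ∘ (inside ∷_))) (cubeSum-*ʳ n a (g ∘ (outside ∷_))))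
  (sym (ℚₚ.*-distribʳ-+ a (cubeSum n (g ∘ (inside ∷_))) (cubeSum n (g ∘ (outside ∷_)))))

cubeSum-comm : ∀ n m (F : Subset n → Subset m → ℚ) →
  cubeSum n (λ x → cubeSum m (F x)) ≡ cubeSum m (λ z → cubeSum n (λ x → F x z))
cubeSum-comm zero    m F = refl
cubeSum-comm (suc n) m F = trans
  (cong₂ _+_ (cubeSum-comm n m (F ∘ (inside ∷_))) (cubeSum-comm n m (F ∘ (outside ∷_))))
  (sym (cubeSum-+ m (λ z → cubeSum n (λ x → F (inside ∷ x) z)) (λ z → cubeSum n (λ x → F (outside ∷ x) z))))

bit : Bool → ℚ
bit b = if b then 1ℚ else 0ℚ

bit-idem : ∀ b → bit b * bit b ≡ bit b
bit-idem true  = refl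
bit-idem false = refl

monomial-∪ : ∀ {n} (I J x : Subset n) → monomial (I ∪ J) x ≡ monomial I x * monomial J x
monomial-∪ []          []          []      = refl
monomial-∪ (true ∷ I)  (true ∷ J)  (b ∷ x) = begin
  bit b * monomial (I ∪ J) x                            ≡⟨ cong₂ _*_ (sym (bit-idem b)) (monomial-∪ I J x) ⟩
  (bit b * bit b) * (monomial I x * monomial J x)       ≡⟨ *-interchange (bit b) (bit b) (monomial I x) (monomial J x) ⟩
  (bit b * monomial I x) * (bit b * monomial J x)       ∎
  where open ≡-Reasoning
monomial-∪ (true ∷ I)  (false ∷ J) (b ∷ x) =
  trans (cong (bit b *_) (monomial-∪ I J x)) (sym (ℚₚ.*-assoc (bit b) (monomial I x) (monomial J x)))
monomial-∪ (false ∷ I) (true ∷ J)  (b ∷ x) =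
  trans (cong (bit b *_) (monomial-∪ I J x)) (*-leftSwap (bit b) (monomial I x) (monomial J x))
monomial-∪ (false ∷ I) (false ∷ J) (b ∷ x) = monomial-∪ I J x

poly : ∀ {n} → (Subset n → ℚ) → Subset n → ℚ
poly {n} v x = cubeSum n (λ I → v I * monomial I x)

-- Möbius inversion: the signed measure on {0,1}ⁿ whose moment sequence is y.
mobius : ∀ {n} → (Subset n → ℚ) → Subset n → ℚ
mobius {zero}  y []          = y []
mobius {suc n} y (true ∷ x)  = mobius (y ∘ (inside ∷_)) x
mobius {suc n} y (false ∷ x) = mobius (λ K → y (outside ∷ K) - y (inside ∷ K)) x

moment-mobius : ∀ n (y : Subset n → ℚ) (K : Subset n) →
  y K ≡ cubeSum n (λ x → mobius y x * monomial K x)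
moment-mobius zero    y []          = sym (ℚₚ.*-identityʳ (y []))
moment-mobius (suc n) y (true ∷ K)  = begin
  y (inside ∷ K)
    ≡⟨ moment-mobius n y⁺ K ⟩
  cubeSum n (λ x → mobius y⁺ x * monomial K x)
    ≡⟨ ℚₚ.+-identityʳ _ ⟨
  cubeSum n (λ x → mobius y⁺ x * monomial K x) + 0ℚ
    ≡⟨ cong₂ _+_ (cubeSum-cong n λ x → cong (mobius y⁺ x *_) (ℚₚ.*-identityˡ (monomial K x)))
                 (cubeSum-0 n λ x → trans (cong (mobius y⁻ x *_) (ℚₚ.*-zeroˡ (monomial K x)))
                                          (ℚₚ.*-zeroʳ (mobius y⁻ x))) ⟨
  cubeSum (suc n) (λ x → mobius y x * monomial (true ∷ K) x) ∎
  where
  open ≡-Reasoning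
  y⁺ y⁻ : Subset n → ℚ
  y⁺ = y ∘ (inside ∷_)
  y⁻ = λ K → y (outside ∷ K) - y (inside ∷ K)
moment-mobius (suc n) y (false ∷ K) = begin
  y (outside ∷ K)
    ≡⟨ a+[b-a]≡b (y (inside ∷ K)) (y (outside ∷ K)) ⟨
  y (inside ∷ K) + (y (outside ∷ K) - y (inside ∷ K))
    ≡⟨ cong₂ _+_ (moment-mobius n y⁺ K) (moment-mobius n y⁻ K) ⟩
  cubeSum (suc n) (λ x → mobius y x * monomial (false ∷ K) x) ∎
  where
  open ≡-Reasoning
  y⁺ y⁻ : Subset n → ℚ
  y⁺ = y ∘ (inside ∷_)
  y⁻ = λ K → y (outside ∷ K) - y (inside ∷ K)
  a+[b-a]≡b : ∀ a b → a + (b - a) ≡ b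
  a+[b-a]≡b = solve-∀ ℚ-ring

coef : ∀ {n} → (Subset n → ℚ) → Subset n → ℚ
coef {zero}  h []          = h []
coef {suc n} h (true ∷ I)  = coef (λ x → h (inside ∷ x) - h (outside ∷ x)) I
coef {suc n} h (false ∷ I) = coef (h ∘ (outside ∷_)) I

coef-expansion : ∀ n (h : Subset n → ℚ) (x : Subset n) → h x ≡ poly (coef h) x
coef-expansion zero    h []      = sym (ℚₚ.*-identityʳ (h []))
coef-expansion (suc n) h (b ∷ x) = begin
  h (b ∷ x)
    ≡⟨ interpolate b ⟩
  bit b * hΔ x + h⁻ x
    ≡⟨ cong₂ _+_ (cong (bit b *_) (coef-expansion n hΔ x)) (coef-expansion n h⁻ x) ⟩
  bit b * poly (coef hΔ) x + poly (coef h⁻) x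
    ≡⟨ cong (_+ poly (coef h⁻) x) (cubeSum-*ˡ n (bit b) _) ⟨
  cubeSum n (λ I → bit b * (coef hΔ I * monomial I x)) + poly (coef h⁻) x
    ≡⟨ cong (_+ poly (coef h⁻) x) (cubeSum-cong n λ I → *-leftSwap (bit b) (coef hΔ I) (monomial I x)) ⟩
  poly (coef h) (b ∷ x) ∎
  where
  open ≡-Reasoning
  hΔ h⁻ : Subset n → ℚ
  hΔ x = h (inside ∷ x) - h (outside ∷ x)
  h⁻ = h ∘ (outside ∷_)
  interpolate : ∀ b → h (b ∷ x) ≡ bit b * hΔ x + h⁻ x
  interpolate true  = p≡1*[p-q]+q (h (inside ∷ x)) (h (outside ∷ x))
    where
    p≡1*[p-q]+q : ∀ p q → p ≡ 1ℚ * (p - q) + q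
    p≡1*[p-q]+q = solve-∀ ℚ-ring
  interpolate false = sym (trans (cong (_+ h⁻ x) (ℚₚ.*-zeroˡ (hΔ x))) (ℚₚ.+-identityˡ (h⁻ x)))

coef-cong : ∀ {n} {g k : Subset n → ℚ} → (∀ x → g x ≡ k x) → ∀ I → coef g I ≡ coef k I
coef-cong {zero}  g≡k []          = g≡k []
coef-cong {suc n} g≡k (true ∷ I)  = coef-cong (λ x → cong₂ _-_ (g≡k (inside ∷ x)) (g≡k (outside ∷ x))) I
coef-cong {suc n} g≡k (false ∷ I) = coef-cong (g≡k ∘ (outside ∷_)) I

coef-+ : ∀ {n} (g k : Subset n → ℚ) I → coef (λ x → g x + k x) I ≡ coef g I + coef k I
coef-+ {zero}  g k []          = refl
coef-+ {suc n} g k (true ∷ I)  = trans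
  (coef-cong (λ x → [a+b]-[c+d] (g (inside ∷ x)) (k (inside ∷ x)) (g (outside ∷ x)) (k (outside ∷ x))) I)
  (coef-+ _ _ I)
  where
  [a+b]-[c+d] : ∀ a b c d → (a + b) - (c + d) ≡ (a - c) + (b - d)
  [a+b]-[c+d] = solve-∀ ℚ-ring
coef-+ {suc n} g k (false ∷ I) = coef-+ _ _ I

coef-*ˡ : ∀ {n} (a : ℚ) (g : Subset n → ℚ) I → coef (λ x → a * g x) I ≡ a * coef g I
coef-*ˡ {zero}  a g []          = refl
coef-*ˡ {suc n} a g (true ∷ I)  = trans
  (coef-cong (λ x → sym (*-distribˡ-- a (g (inside ∷ x)) (g (outside ∷ x)))) I)
  (coef-*ˡ a _ I)
  where
  *-distribˡ-- : ∀ a b c → a * (b - c) ≡ a * b - a * c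
  *-distribˡ-- = solve-∀ ℚ-ring
coef-*ˡ {suc n} a g (false ∷ I) = coef-*ˡ a _ I

_≟ₛ_ : ∀ {n} (A B : Subset n) → Dec (A ≡ B)
_≟ₛ_ = ≡-dec Bool._≟_

δ : ∀ {n} → Subset n → Subset n → ℚ
δ A x = if does (A ≟ₛ x) then 1ℚ else 0ℚ

δ-refl : ∀ {n} (A : Subset n) → δ A A ≡ 1ℚ
δ-refl A = cong (if_then 1ℚ else 0ℚ) (dec-true (A ≟ₛ A) refl)

δ-≢ : ∀ {n} {A x : Subset n} → A ≢ x → δ A x ≡ 0ℚ
δ-≢ {A = A} {x} A≢x = cong (if_then 1ℚ else 0ℚ) (dec-false (A ≟ₛ x) A≢x)

sgn : ∀ {n} → Subset n → ℚ
sgn []          = 1ℚ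
sgn (true ∷ A)  = sgn A
sgn (false ∷ A) = - sgn A

sgn² : ∀ {n} (A : Subset n) → sgn A * sgn A ≡ 1ℚ
sgn² []          = refl
sgn² (true ∷ A)  = sgn² A
sgn² (false ∷ A) = trans (-a*-a≡a*a (sgn A)) (sgn² A)
  where
  -a*-a≡a*a : ∀ a → (- a) * (- a) ≡ a * a
  -a*-a≡a*a = solve-∀ ℚ-ring

coef-δ-⊤ : ∀ n (A : Subset n) → coef (δ A) ⊤ ≡ sgn A
coef-δ-⊤ zero    []          = refl
coef-δ-⊤ (suc n) (true ∷ A)  = trans (coef-cong (λ x → ℚₚ.+-identityʳ (δ A x)) ⊤) (coef-δ-⊤ n A)
coef-δ-⊤ (suc n) (false ∷ A) = begin
  coef (λ x → 0ℚ - δ A x) ⊤      ≡⟨ coef-cong (λ x → 0-a≡-1*a (δ A x)) ⊤ ⟩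
  coef (λ x → - 1ℚ * δ A x) ⊤    ≡⟨ coef-*ˡ (- 1ℚ) (δ A) ⊤ ⟩
  - 1ℚ * coef (δ A) ⊤            ≡⟨ cong (- 1ℚ *_) (coef-δ-⊤ n A) ⟩
  - 1ℚ * sgn A                   ≡⟨ 0-a≡-1*a (sgn A) ⟨
  0ℚ - sgn A                     ≡⟨ ℚₚ.+-identityˡ (- sgn A) ⟩
  - sgn A                        ∎
  where
  open ≡-Reasoning
  0-a≡-1*a : ∀ a → 0ℚ - a ≡ - 1ℚ * a
  0-a≡-1*a = solve-∀ ℚ-ring

DegreeAtMost : ∀ {n} → ℕ → (Subset n → ℚ) → Set
DegreeAtMost t h = ∀ I → t < ∣ I ∣ → coef h I ≡ 0ℚ

coef-⊤≡0⇒degree<n : ∀ n (h : Subset n → ℚ) → coef h ⊤ ≡ 0ℚ → DegreeAtMost (n ∸ 1) h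
coef-⊤≡0⇒degree<n zero    h _      [] ()
coef-⊤≡0⇒degree<n (suc m) h top≡0 I m<∣I∣ =
  trans (cong (coef h) (∣p∣≡n⇒p≡⊤ {p = I} (ℕₚ.≤-antisym (∣p∣≤n I) m<∣I∣))) top≡0

sumL-𝒫 : ∀ n t (g : Subset n → ℚ) → (∀ I → t < ∣ I ∣ → g I ≡ 0ℚ) → sumL (𝒫 n t) g ≡ cubeSum n g
sumL-𝒫 n t g g≡0 = trans
  (sumL-filter (λ I → ∣ I ∣ ≤ℕ? t) (allSubsets n) g (λ I ∣I∣≰t → g≡0 I (ℕₚ.≰⇒> ∣I∣≰t)))
  (ΣSub≡cubeSum n g)

moment-linear : ∀ n (c y : Subset n → ℚ) →
  cubeSum n (λ K → c K * y K) ≡ cubeSum n (λ x → mobius y x * poly c x)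
moment-linear n c y = begin
  cubeSum n (λ K → c K * y K)
    ≡⟨ cubeSum-cong n (λ K → cong (c K *_) (moment-mobius n y K)) ⟩
  cubeSum n (λ K → c K * cubeSum n (λ x → μ x * monomial K x))
    ≡⟨ cubeSum-cong n (λ K → cubeSum-*ˡ n (c K) _) ⟨
  cubeSum n (λ K → cubeSum n (λ x → c K * (μ x * monomial K x)))
    ≡⟨ cubeSum-comm n n _ ⟩
  cubeSum n (λ x → cubeSum n (λ K → c K * (μ x * monomial K x)))
    ≡⟨ cubeSum-cong n (λ x → cubeSum-cong n λ K → *-leftSwap (c K) (μ x) (monomial K x)) ⟩
  cubeSum n (λ x → cubeSum n (λ K → μ x * (c K * monomial K x)))
    ≡⟨ cubeSum-cong n (λ x → cubeSum-*ˡ n (μ x) _) ⟩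
  cubeSum n (λ x → μ x * poly c x) ∎
  where
  open ≡-Reasoning
  μ = mobius y

moment-quadratic : ∀ n (v y : Subset n → ℚ) →
  cubeSum n (λ I → cubeSum n (λ J → v I * v J * y (I ∪ J))) ≡
  cubeSum n (λ x → mobius y x * (poly v x * poly v x))
moment-quadratic n v y = begin
  cubeSum n (λ I → cubeSum n (λ J → v I * v J * y (I ∪ J)))
    ≡⟨ cubeSum-cong n (λ I → cubeSum-cong n (λ J → expand I J)) ⟩
  cubeSum n (λ I → cubeSum n (λ J → cubeSum n (λ x → μ x * (a I x * a J x))))
    ≡⟨ cubeSum-cong n (λ I → cubeSum-comm n n _) ⟩
  cubeSum n (λ I → cubeSum n (λ x → cubeSum n (λ J → μ x * (a I x * a J x))))
    ≡⟨ cubeSum-comm n n _ ⟩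
  cubeSum n (λ x → cubeSum n (λ I → cubeSum n (λ J → μ x * (a I x * a J x))))
    ≡⟨ cubeSum-cong n (λ x → collect x) ⟩
  cubeSum n (λ x → μ x * (poly v x * poly v x)) ∎
  where
  open ≡-Reasoning
  μ = mobius y
  a : Subset n → Subset n → ℚ
  a I x = v I * monomial I x
  expand : ∀ I J → v I * v J * y (I ∪ J) ≡ cubeSum n (λ x → μ x * (a I x * a J x))
  expand I J = begin
    v I * v J * y (I ∪ J)
      ≡⟨ cong (v I * v J *_) (moment-mobius n y (I ∪ J)) ⟩
    v I * v J * cubeSum n (λ x → μ x * monomial (I ∪ J) x)
      ≡⟨ cubeSum-*ˡ n (v I * v J) _ ⟨
    cubeSum n (λ x → v I * v J * (μ x * monomial (I ∪ J) x))
      ≡⟨ cubeSum-cong n (λ x → cong (λ m → v I * v J * (μ x * m)) (monomial-∪ I J x)) ⟩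
    cubeSum n (λ x → v I * v J * (μ x * (monomial I x * monomial J x)))
      ≡⟨ cubeSum-cong n (λ x → regroup (v I) (v J) (μ x) (monomial I x) (monomial J x)) ⟩
    cubeSum n (λ x → μ x * (a I x * a J x)) ∎
    where
    regroup : ∀ a b u p q → a * b * (u * (p * q)) ≡ u * ((a * p) * (b * q))
    regroup = solve-∀ ℚ-ring
  collect : ∀ x → cubeSum n (λ I → cubeSum n (λ J → μ x * (a I x * a J x))) ≡ μ x * (poly v x * poly v x)
  collect x = begin
    cubeSum n (λ I → cubeSum n (λ J → μ x * (a I x * a J x)))
      ≡⟨ cubeSum-cong n (λ I → trans (cubeSum-*ˡ n (μ x) _) (cong (μ x *_) (cubeSum-*ˡ n (a I x) _))) ⟩
    cubeSum n (λ I → μ x * (a I x * poly v x))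
      ≡⟨ cubeSum-*ˡ n (μ x) _ ⟩
    μ x * cubeSum n (λ I → a I x * poly v x)
      ≡⟨ cong (μ x *_) (cubeSum-*ʳ n (poly v x) _) ⟩
    μ x * (poly v x * poly v x) ∎

sumL-𝒫² : ∀ n t (v y : Subset n → ℚ) → (∀ I → t < ∣ I ∣ → v I ≡ 0ℚ) →
  sumL (𝒫 n t) (λ I → sumL (𝒫 n t) (λ J → v I * v J * y (I ∪ J))) ≡
  cubeSum n (λ I → cubeSum n (λ J → v I * v J * y (I ∪ J)))
sumL-𝒫² n t v y v≡0 = begin
  sumL (𝒫 n t) (λ I → sumL (𝒫 n t) (λ J → v I * v J * y (I ∪ J)))
    ≡⟨ sumL-cong (𝒫 n t) (λ I → sumL-𝒫 n t _ λ J big → vanishʳ I J (v≡0 J big)) ⟩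
  sumL (𝒫 n t) (λ I → cubeSum n (λ J → v I * v J * y (I ∪ J)))
    ≡⟨ sumL-𝒫 n t _ (λ I big → cubeSum-0 n (vanishˡ I (v≡0 I big))) ⟩
  cubeSum n (λ I → cubeSum n (λ J → v I * v J * y (I ∪ J))) ∎
  where
  open ≡-Reasoning
  a*0*b≡0 : ∀ a b → a * 0ℚ * b ≡ 0ℚ
  a*0*b≡0 = solve-∀ ℚ-ring
  0*a*b≡0 : ∀ a b → 0ℚ * a * b ≡ 0ℚ
  0*a*b≡0 = solve-∀ ℚ-ring
  vanishʳ : ∀ I J → v J ≡ 0ℚ → v I * v J * y (I ∪ J) ≡ 0ℚ
  vanishʳ I J vJ≡0 = trans (cong (λ w → v I * w * y (I ∪ J)) vJ≡0) (a*0*b≡0 (v I) (y (I ∪ J)))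
  vanishˡ : ∀ I → v I ≡ 0ℚ → ∀ J → v I * v J * y (I ∪ J) ≡ 0ℚ
  vanishˡ I vI≡0 J = trans (cong (λ w → w * v J * y (I ∪ J)) vI≡0) (0*a*b≡0 (v J) (y (I ∪ J)))

square⇒nonneg : ∀ n t (f c h y : Subset n → ℚ) →
  IsMultilinearRep n f c → (∀ x → f x ≡ h x * h x) → DegreeAtMost t h → MomentPSD n t y →
  0ℚ ≤ cubeSum n (λ K → c K * y K)
square⇒nonneg n t f c h y rep f≡h² deg psd = subst (0ℚ ≤_) form≡objective (psd v)
  where
  open ≡-Reasoning
  v = coef h
  μ = mobius y
  form≡objective :
    sumL (𝒫 n t) (λ I → sumL (𝒫 n t) (λ J → v I * v J * y (I ∪ J))) ≡ cubeSum n (λ K → c K * y K)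
  form≡objective = begin
    sumL (𝒫 n t) (λ I → sumL (𝒫 n t) (λ J → v I * v J * y (I ∪ J)))
      ≡⟨ sumL-𝒫² n t v y deg ⟩
    cubeSum n (λ I → cubeSum n (λ J → v I * v J * y (I ∪ J)))
      ≡⟨ moment-quadratic n v y ⟩
    cubeSum n (λ x → μ x * (poly v x * poly v x))
      ≡⟨ cubeSum-cong n (λ x → cong (λ p → μ x * (p * p)) (coef-expansion n h x)) ⟨
    cubeSum n (λ x → μ x * (h x * h x))
      ≡⟨ cubeSum-cong n (λ x → cong (μ x *_) (trans (sym (f≡h² x)) (trans (rep x) (ΣSub≡cubeSum n _)))) ⟩
    cubeSum n (λ x → μ x * poly c x)
      ≡⟨ moment-linear n c y ⟨
    cubeSum n (λ K → c K * y K) ∎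

balance : ∀ {n} → Subset n → Subset n → ℚ
balance A B = - (sgn A * sgn B)

balance² : ∀ {n} (A B : Subset n) → balance A B * balance A B ≡ 1ℚ
balance² A B = begin
  (- (sgn A * sgn B)) * (- (sgn A * sgn B)) ≡⟨ -[ab]*-[ab] (sgn A) (sgn B) ⟩
  (sgn A * sgn A) * (sgn B * sgn B)         ≡⟨ cong₂ _*_ (sgn² A) (sgn² B) ⟩
  1ℚ                                        ∎
  where
  open ≡-Reasoning
  -[ab]*-[ab] : ∀ a b → (- (a * b)) * (- (a * b)) ≡ (a * a) * (b * b)
  -[ab]*-[ab] = solve-∀ ℚ-ring

twoPointRoot : ∀ {n} → Subset n → Subset n → Subset n → ℚ
twoPointRoot A B x = δ A x + balance A B * δ B x

coef-twoPointRoot-⊤ : ∀ n (A B : Subset n) → coef (twoPointRoot A B) ⊤ ≡ 0ℚ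
coef-twoPointRoot-⊤ n A B = begin
  coef (twoPointRoot A B) ⊤                     ≡⟨ coef-+ (δ A) (λ x → balance A B * δ B x) ⊤ ⟩
  coef (δ A) ⊤ + coef (λ x → s * δ B x) ⊤       ≡⟨ cong (coef (δ A) ⊤ +_) (coef-*ˡ s (δ B) ⊤) ⟩
  coef (δ A) ⊤ + s * coef (δ B) ⊤               ≡⟨ cong₂ (λ p q → p + s * q) (coef-δ-⊤ n A) (coef-δ-⊤ n B) ⟩
  sgn A + s * sgn B                             ≡⟨ cancel (sgn A) (sgn B) ⟩
  sgn A - sgn A * (sgn B * sgn B)               ≡⟨ cong (λ q → sgn A - sgn A * q) (sgn² B) ⟩
  sgn A - sgn A * 1ℚ                            ≡⟨ a-a*1≡0 (sgn A) ⟩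
  0ℚ                                            ∎
  where
  open ≡-Reasoning
  s = balance A B
  cancel : ∀ a b → a + (- (a * b)) * b ≡ a - a * (b * b)
  cancel = solve-∀ ℚ-ring
  a-a*1≡0 : ∀ a → a - a * 1ℚ ≡ 0ℚ
  a-a*1≡0 = solve-∀ ℚ-ring

module _ {n} {A B : Subset n} where
  open ≡-Reasoning

  private
    s : ℚ
    s = balance A B

  twoPointRoot-at₁ : A ≢ B → twoPointRoot A B A ≡ 1ℚ
  twoPointRoot-at₁ A≢B = begin
    δ A A + s * δ B A ≡⟨ cong₂ (λ p q → p + s * q) (δ-refl A) (δ-≢ (A≢B ∘ sym)) ⟩
    1ℚ + s * 0ℚ       ≡⟨ cong (1ℚ +_) (ℚₚ.*-zeroʳ s) ⟩
    1ℚ                ∎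

  twoPointRoot-at₂ : A ≢ B → twoPointRoot A B B ≡ s
  twoPointRoot-at₂ A≢B = begin
    δ A B + s * δ B B ≡⟨ cong₂ (λ p q → p + s * q) (δ-≢ A≢B) (δ-refl B) ⟩
    0ℚ + s * 1ℚ       ≡⟨ ℚₚ.+-identityˡ (s * 1ℚ) ⟩
    s * 1ℚ            ≡⟨ ℚₚ.*-identityʳ s ⟩
    s                 ∎

  twoPointRoot-elsewhere : ∀ {x} → x ≢ A → x ≢ B → twoPointRoot A B x ≡ 0ℚ
  twoPointRoot-elsewhere {x} x≢A x≢B = begin
    δ A x + s * δ B x ≡⟨ cong₂ (λ p q → p + s * q) (δ-≢ (x≢A ∘ sym)) (δ-≢ (x≢B ∘ sym)) ⟩
    0ℚ + s * 0ℚ       ≡⟨ cong (0ℚ +_) (ℚₚ.*-zeroʳ s) ⟩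
    0ℚ                ∎

  twoPointRoot-square : (f : Subset n → ℚ) → A ≢ B →
    f A ≡ 1ℚ → f B ≡ 1ℚ → (∀ x → x ≢ A → x ≢ B → f x ≡ 0ℚ) →
    ∀ x → f x ≡ twoPointRoot A B x * twoPointRoot A B x
  twoPointRoot-square f A≢B fA≡1 fB≡1 f≡0 x with x ≟ₛ A | x ≟ₛ B
  ... | yes refl | _        = begin
    f A      ≡⟨ fA≡1 ⟩
    1ℚ * 1ℚ  ≡⟨ cong₂ _*_ (twoPointRoot-at₁ A≢B) (twoPointRoot-at₁ A≢B) ⟨
    twoPointRoot A B A * twoPointRoot A B A ∎
  ... | no _     | yes refl = begin
    f B      ≡⟨ fB≡1 ⟩
    1ℚ       ≡⟨ balance² A B ⟨
    s * s    ≡⟨ cong₂ _*_ (twoPointRoot-at₂ A≢B) (twoPointRoot-at₂ A≢B) ⟨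
    twoPointRoot A B B * twoPointRoot A B B ∎
  ... | no x≢A   | no x≢B   = begin
    f x      ≡⟨ f≡0 x x≢A x≢B ⟩
    0ℚ * 0ℚ  ≡⟨ cong₂ _*_ (twoPointRoot-elsewhere x≢A x≢B) (twoPointRoot-elsewhere x≢A x≢B) ⟨
    twoPointRoot A B x * twoPointRoot A B x ∎

minL-≤ : {A : Set} (f : A → ℚ) (xs : List A) (d : ℚ) {x : A} → x ∈ xs → minL (map f xs) d ≤ f x
minL-≤ f (x ∷ xs) d (here refl) = ℚₚ.p⊓q≤p (f x) (minL (map f xs) d)
minL-≤ f (z ∷ xs) d (there x∈xs) = ℚₚ.≤-trans (ℚₚ.p⊓q≤q (f z) (minL (map f xs) d)) (minL-≤ f xs d x∈xs)

∈-allSubsets : ∀ n (x : Subset n) → x ∈ allSubsets n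
∈-allSubsets zero    []          = here refl
∈-allSubsets (suc n) (true ∷ x)  = ∈-++⁺ˡ (∈-map⁺ (inside ∷_) (∈-allSubsets n x))
∈-allSubsets (suc n) (false ∷ x) =
  ∈-++⁺ʳ (map (inside ∷_) (allSubsets n)) (∈-map⁺ (outside ∷_) (∈-allSubsets n x))

minF-≤ : ∀ n (f : Subset n → ℚ) (x : Subset n) → minF n f ≤ f x
minF-≤ n f x = minL-≤ f (allSubsets n) _ (∈-allSubsets n x)

avoid-two : ∀ m (A B : Subset (suc (suc m))) → ∃ λ J → J ≢ A × J ≢ B
avoid-two m (a ∷ A) (_ ∷ b ∷ B) =
  not a ∷ not b ∷ replicate m outside ,
  (λ J≡A → not-¬ refl (sym (∷-injectiveˡ J≡A))) ,
  (λ J≡B → not-¬ refl (sym (∷-injectiveˡ (∷-injectiveʳ J≡B))))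

-- At level 0 the objective is c ∅ · y ∅ = f ∅, whatever f is.
noIntegralityGap-dim1 : (f c : Subset 1 → ℚ) → IsMultilinearRep 1 f c → NoIntegralityGap 1 f c
noIntegralityGap-dim1 f c rep y (y∅≡1 , _) = begin
  minF 1 f                           ≤⟨ minF-≤ 1 f ∅ ⟩
  f ∅                                ≡⟨ rep ∅ ⟩
  c ⊤ * (0ℚ * 1ℚ) + (c ∅ * 1ℚ + 0ℚ)  ≡⟨ drop-first (c ⊤) (c ∅ * 1ℚ) ⟩
  c ∅ * 1ℚ + 0ℚ                      ≡⟨ cong (λ t → c ∅ * t + 0ℚ) y∅≡1 ⟨
  lasserreObj 1 c y                  ∎
  where
  open ℚₚ.≤-Reasoning
  ∅ : Subset 1
  ∅ = outside ∷ []
  drop-first : ∀ a b → a * (0ℚ * 1ℚ) + (b + 0ℚ) ≡ b + 0ℚ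
  drop-first = solve-∀ ℚ-ring

lasserreObj≡cubeSum : ∀ m (c y : Subset (suc (suc m)) → ℚ) →
  lasserreObj (suc (suc m)) c y ≡ cubeSum (suc (suc m)) (λ K → c K * y K)
lasserreObj≡cubeSum m c y =
  sumL-𝒫 n (2 *ℕ n ∸ 2) (λ K → c K * y K)
    (λ I big → ⊥-elim (ℕₚ.<⇒≱ big (ℕₚ.≤-trans (∣p∣≤n I) n≤2n∸2)))
  where
  n = suc (suc m)
  n≤2n∸2 : n ≤ℕ 2 *ℕ n ∸ 2
  n≤2n∸2 = ℕₚ.≤-trans (s≤s (s≤s (ℕₚ.m≤m+n m 0))) (ℕₚ.m≤n+m (suc (suc (m +ℕ 0))) m)

lemma8 : (n : ℕ) (f c : Subset n → ℚ) (I₁ I₂ : Subset n) →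
    I₁ ≢ I₂ → f I₁ ≡ 1ℚ → f I₂ ≡ 1ℚ →
    ((I : Subset n) → I ≢ I₁ → I ≢ I₂ → f I ≡ 0ℚ) →
    IsMultilinearRep n f c →
    NoIntegralityGap n f c
lemma8 zero f c [] [] I₁≢I₂ _ _ _ _ = ⊥-elim (I₁≢I₂ refl)
lemma8 (suc zero) f c _ _ _ _ _ _ rep = noIntegralityGap-dim1 f c rep
lemma8 n@(suc (suc m)) f c I₁ I₂ I₁≢I₂ fI₁≡1 fI₂≡1 f≡0 rep y (_ , psd) with avoid-two m I₁ I₂
... | J , J≢I₁ , J≢I₂ = begin
  minF n f                     ≤⟨ minF-≤ n f J ⟩
  f J                          ≡⟨ f≡0 J J≢I₁ J≢I₂ ⟩
  0ℚ                           ≤⟨ square⇒nonneg n (n ∸ 1) f c h y rep f≡h² h-degree psd ⟩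
  cubeSum n (λ K → c K * y K)  ≡⟨ lasserreObj≡cubeSum m c y ⟨
  lasserreObj n c y            ∎
  where
  open ℚₚ.≤-Reasoning
  h : Subset n → ℚ
  h = twoPointRoot I₁ I₂
  f≡h² : ∀ x → f x ≡ h x * h x
  f≡h² = twoPointRoot-square f I₁≢I₂ fI₁≡1 fI₂≡1 f≡0
  h-degree : DegreeAtMost (n ∸ 1) h
  h-degree = coef-⊤≡0⇒degree<n n h (coef-twoPointRoot-⊤ n I₁ I₂)
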